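{- Let $n\ge 1$. Define the following $n\times n$ matrices whose entries are monomials (rows and columns indexed by $i,j\in\{1,\dots,n\}$): (i) $\mathbf{Q}_n$ in the $4n-2$ variables $x_1,\dots,x_{2n-1},y_1,\dots,y_{2n-1}$, with $(i,j)$ entry $x_{n-i+j}\,y_{2n-i-j+1}$; (ii) $\mathbf{T}_n$ in the $2n$ variables $x_r,y_r$ ($r\in\mathbb{Z}/n\mathbb{Z}$), with $(i,j)$ entry $x_{(n-i+j)\bmod n}\,y_{(2n-i-j+1)\bmod n}$; (iii) $\mathbf{S}_n$ in the $2n-1$ variables $x_1,\dots,x_{2n-1}$, with $(i,j)$ entry $x_{n-i+j}$; (iv) $\mathbf{Z}_n$ in the $n$ variables $x_r$ ($r\in\mathbb{Z}/n\mathbb{Z}$), with $(i,j)$ entry $x_{(n-i+j)\bmod n}$. Then $g(\mathrm{per}(\mathbf{Q}_n),2n)=Q(n)$, $g(\mathrm{per}(\mathbf{T}_n),2n)=T(n)$, $g(\mathrm{per}(\mathbf{S}_n),n)=S(n)$, and $g(\mathrm{per}(\mathbf{Z}_n),n)=TS(n)$.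
   Context: The permanent of an $n\times n$ matrix $A=(a_{i,j})$ is $\mathrm{per}(A)=\sum_{\sigma\in S_n}\prod_{i=1}^n a_{i,\sigma(i)}$. For a polynomial $P$ and $k\in\mathbb{N}$, $g(P,k)$ denotes the sum of the coefficients of those monomials of $P$ in which exactly $k$ distinct variables occur. Squares of an $n\times n$ board are indexed $(i,j)$ with row $i$ (row $1$ at the top) and column $j$. $Q(n)$ is the number of ways to place $n$ queens on the $n\times n$ board so that no two share a row, a column, a northwest-southeast diagonal (same $j-i$) or a northeast-southwest diagonal (same $i+j$). $S(n)$ (semi-queens) is the number of placements of $n$ pieces with no two sharing a row, column, or northwest-southeast diagonal (same $j-i$). $T(n)$ (toroidal queens) is the number of placements of $n$ pieces with no two sharing a row, column, value of $j-i \bmod n$, or value of $i+j\bmod n$. $TS(n)$ (toroidal semi-queens) is the number of placements of $n$ pieces with no two sharing a row, column, or value of $j-i\bmod n$. -}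

module Defs where

open import Data.Nat using (ℕ; zero; suc; _+_; _*_; _∸_; NonZero)
open import Data.Nat.DivMod using (_%_)
import Data.Nat.Properties as ℕP
open import Data.Integer as ℤ using (ℤ; +_; _-_)
open import Data.Integer.DivMod using (_%ℕ_)
import Data.Integer.Properties as ℤP
open import Data.Fin using (Fin; toℕ)
open import Data.Fin.Properties using (all?) renaming (_≟_ to _≟F_)
open import Data.Vec using (Vec; []; _∷_; lookup)
open import Data.List using (List; []; _∷_; [_]; map; concatMap; filter; length; allFin; deduplicate)
open import Data.Nat.ListAction using (sum)
open import Data.Product using (_×_; _,_; proj₁; proj₂)
open import Relation.Nullary using (Dec; yes; no; ¬_; ¬?)
open import Relation.Nullary.Decidable using (_→-dec_; _×-dec_)
open import Relation.Unary using (Decidable)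
open import Relation.Binary.PropositionalEquality using (_≡_; _≢_; refl)
open import Relation.Binary using (DecidableEquality)

data Var : Set where
  x : ℕ → Var
  y : ℕ → Var

_≟V_ : DecidableEquality Var
x a ≟V x b with a ℕP.≟ b
... | yes refl = yes refl
... | no a≢b = no λ { refl → a≢b refl }
x a ≟V y b = no λ ()
y a ≟V x b = no λ ()
y a ≟V y b with a ℕP.≟ b
... | yes refl = yes refl
... | no a≢b = no λ { refl → a≢b refl }

-- A monomial (with coefficient 1) is a product of variables, stored
-- as the list of its factors counted with multiplicity.
Monomial : Set
Monomial = List Var

numVars : Monomial → ℕ
numVars m = length (deduplicate _≟V_ m)

Poly : Set
Poly = List (ℕ × Monomial)

-- g(P,k): sum of the coefficients of the monomials of P in which exactly
-- k distinct variables occur.  (Collecting like terms does not change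
-- this value, since whether a term is counted depends only on its monomial.)
g : Poly → ℕ → ℕ
g P k = sum (map proj₁ (filter (λ t → numVars (proj₂ t) ℕP.≟ k) P))

allVecs : (k m : ℕ) → List (Vec (Fin m) k)
allVecs zero    m = [ [] ]
allVecs (suc k) m = concatMap (λ c → map (c ∷_) (allVecs k m)) (allFin m)

IsPerm : ∀ {n} → Vec (Fin n) n → Set
IsPerm {n} σ = ∀ i j → lookup σ i ≡ lookup σ j → i ≡ j

isPerm? : ∀ {n} → Decidable (IsPerm {n})
isPerm? σ = all? λ i → all? λ j → (lookup σ i ≟F lookup σ j) →-dec (i ≟F j)

perms : (n : ℕ) → List (Vec (Fin n) n)
perms n = filter isPerm? (allVecs n n)

per : ∀ {n} → (Fin n → Fin n → Monomial) → Poly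
per {n} A = map (λ σ → 1 , concatMap (λ i → A i (lookup σ i)) (allFin n)) (perms n)

-- The four matrices (rows/columns i,j ∈ {1,…,n}; Fin index i stands for toℕ i + 1)

row : ∀ {n} → Fin n → ℕ
row i = suc (toℕ i)

Qmat : (n : ℕ) → Fin n → Fin n → Monomial
Qmat n i j = x ((n ∸ row i) + row j) ∷ y (((2 * n) ∸ (row i + row j)) + 1) ∷ []

Tmat : (n : ℕ) .{{_ : NonZero n}} → Fin n → Fin n → Monomial
Tmat n i j = x (((n ∸ row i) + row j) % n) ∷ y ((((2 * n) ∸ (row i + row j)) + 1) % n) ∷ []

Smat : (n : ℕ) → Fin n → Fin n → Monomial
Smat n i j = x ((n ∸ row i) + row j) ∷ []

Zmat : (n : ℕ) .{{_ : NonZero n}} → Fin n → Fin n → Monomial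
Zmat n i j = x (((n ∸ row i) + row j) % n) ∷ []

-- Placements.  A placement of n pieces with no two in the same row on
-- the n×n board is a map (row i ↦ column σ(i)); the square (i,j) has
-- coordinates i = row i, j = row (σ i).

dif : ∀ {n} → Vec (Fin n) n → Fin n → ℤ
dif σ i = + row (lookup σ i) - + row i

sm : ∀ {n} → Vec (Fin n) n → Fin n → ℕ
sm σ i = row i + row (lookup σ i)

NoShare : ∀ {n} {A : Set} → (Fin n → A) → Set
NoShare f = ∀ i j → i ≢ j → ¬ (f i ≡ f j)

noShare? : ∀ {n} {A : Set} → DecidableEquality A → (f : Fin n → A) → Dec (NoShare f)
noShare? _≟_ f = all? λ i → all? λ j → ¬? (i ≟F j) →-dec ¬? (f i ≟ f j)

count : ∀ {A : Set} {P : A → Set} → Decidable P → List A → ℕ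
count P? xs = length (filter P? xs)

Q : ℕ → ℕ
Q n = count (λ σ → noShare? _≟F_ (lookup σ) ×-dec noShare? ℤP._≟_ (dif σ) ×-dec noShare? ℕP._≟_ (sm σ)) (allVecs n n)

S : ℕ → ℕ
S n = count (λ σ → noShare? _≟F_ (lookup σ) ×-dec noShare? ℤP._≟_ (dif σ)) (allVecs n n)

T : (n : ℕ) .{{_ : NonZero n}} → ℕ
T n = count (λ σ → noShare? _≟F_ (lookup σ) ×-dec noShare? ℕP._≟_ (λ i → dif σ i %ℕ n) ×-dec noShare? ℕP._≟_ (λ i → sm σ i % n)) (allVecs n n)

TS : (n : ℕ) .{{_ : NonZero n}} → ℕ
TS n = count (λ σ → noShare? _≟F_ (lookup σ) ×-dec noShare? ℕP._≟_ (λ i → dif σ i %ℕ n)) (allVecs n n)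

-- Along a permutation σ the entries a_{i,σ(i)} multiply to a monomial with n
-- x-factors (and, for Q and T, n y-factors), so it has the maximal number of
-- distinct variables exactly when the x-indices, and the y-indices, of the
-- factors are pairwise distinct.  The x-index n − i + σ(i) determines and is
-- determined by σ(i) − i, and the y-index 2n − (i + σ(i)) + 1 by i + σ(i);
-- both stay true after reducing mod n.  So the monomials counted by g are
-- exactly those of the non-attacking placements.
module Submission where

open import Defs
open import Data.Nat as ℕ using (ℕ; zero; suc; _+_; _*_; _∸_; _≤_; _<_; z≤n; s≤s; NonZero)
import Data.Nat.Properties as ℕP
open import Data.Nat.DivMod using (_%_; n%n≡0; m<n⇒m%n≡m; m≤n⇒[n∸m]%m≡n%m; %-distribˡ-+; [m+kn]%n≡m%n)
open import Data.Integer using (+_; -_; _⊖_)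
open import Data.Integer.DivMod using (_%ℕ_)
import Data.Integer.Properties as ℤP
open import Algebra.Properties.AbelianGroup ℤP.+-0-abelianGroup using (∙-cancelʳ)
open import Data.Fin using (Fin; zero; suc)
import Data.Fin.Properties as FinP
open import Data.Vec using (Vec; lookup)
open import Data.List using (List; []; _∷_; map; concatMap; filter; length; tabulate; allFin; deduplicate)
import Data.List.Properties as ListP
open import Data.List.Relation.Unary.All using (All; []; _∷_)
open import Data.List.Relation.Unary.AllPairs using ([]; _∷_)
import Data.List.Relation.Unary.All.Properties as AllP
import Data.List.Relation.Unary.AllPairs.Properties as AllPairsP
open import Data.List.Relation.Unary.Unique.Propositional using (Unique)
import Data.List.Relation.Unary.Unique.DecPropositional.Properties as UniqueP
open import Data.Bool using (true; false)
open import Data.Empty using (⊥-elim)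
open import Data.Product using (_×_; _,_; proj₁)
open import Data.Product.Function.NonDependent.Propositional using (_×-⇔_)
open import Function using (id; _∘_; _⇔_; mk⇔; Equivalence)
import Function.Properties.Equivalence as ⇔
open import Function.Related.Propositional using (module EquationalReasoning)
open import Relation.Nullary using (yes; no; ¬_; ¬?; does; _×-dec_)
open import Relation.Unary using (Decidable)
open import Relation.Unary.Properties using (_∩?_)
open import Relation.Binary using (DecidableEquality)
open import Relation.Binary.PropositionalEquality

open Equivalence using (to; from)

module _ {A : Set} {P Q : A → Set} (P? : Decidable P) (Q? : Decidable Q) where

  filter-filter : ∀ xs → filter Q? (filter P? xs) ≡ filter (P? ∩? Q?) xs
  filter-filter [] = refl
  filter-filter (a ∷ xs) with P? a
  ... | no _ = filter-filter xs
  ... | yes _ with Q? a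
  ...   | yes _ = cong (a ∷_) (filter-filter xs)
  ...   | no _ = filter-filter xs

  count-filter : ∀ {R : A → Set} (R? : Decidable R) → (∀ a → (P a × Q a) ⇔ R a) →
                 ∀ xs → count Q? (filter P? xs) ≡ count R? xs
  count-filter R? P×Q⇔R xs = cong length (trans (filter-filter xs)
    (ListP.filter-≐ (P? ∩? Q?) R? ((λ {a} → to (P×Q⇔R a)) , (λ {a} → from (P×Q⇔R a))) xs))

g-unitTerms : ∀ {B : Set} (m : B → Monomial) k bs →
              g (map (λ b → 1 , m b) bs) k ≡ count (λ b → numVars (m b) ℕP.≟ k) bs
g-unitTerms m k [] = refl
g-unitTerms m k (b ∷ bs) with does (numVars (m b) ℕP.≟ k)
... | true  = cong suc (g-unitTerms m k bs)
... | false = g-unitTerms m k bs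

module _ {A : Set} (_≟_ : DecidableEquality A) where

  deduplicate-unique : ∀ {xs} → Unique xs → deduplicate _≟_ xs ≡ xs
  deduplicate-unique {[]} [] = refl
  deduplicate-unique {v ∷ xs} (v∉xs ∷ xs!) = cong (v ∷_) (begin
    filter (¬? ∘ (v ≟_)) (deduplicate _≟_ xs) ≡⟨ cong (filter (¬? ∘ (v ≟_))) (deduplicate-unique xs!) ⟩
    filter (¬? ∘ (v ≟_)) xs                   ≡⟨ ListP.filter-all (¬? ∘ (v ≟_)) v∉xs ⟩
    xs                                        ∎)
    where open ≡-Reasoning

  deduplicate-complete : ∀ xs → length (deduplicate _≟_ xs) ≡ length xs → deduplicate _≟_ xs ≡ xs
  deduplicate-complete []       _  = refl
  deduplicate-complete (v ∷ xs) eq =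
    cong (v ∷_) (trans (ListP.filter-complete v≢? |F|≡|D|) (deduplicate-complete xs |D|≡|xs|))
    where
    v≢? : Decidable (λ z → ¬ v ≡ z)
    v≢? = ¬? ∘ (v ≟_)
    D : List A
    D = deduplicate _≟_ xs
    |F|≡|xs| : length (filter v≢? D) ≡ length xs
    |F|≡|xs| = ℕP.suc-injective eq
    |D|≡|xs| : length D ≡ length xs
    |D|≡|xs| = ℕP.≤-antisym (ListP.length-deduplicate _≟_ xs)
                 (subst (_≤ length D) |F|≡|xs| (ListP.length-filter v≢? D))
    |F|≡|D| : length (filter v≢? D) ≡ length D
    |F|≡|D| = trans |F|≡|xs| (sym |D|≡|xs|)

  length-deduplicate≡length⇔Unique : ∀ xs → length (deduplicate _≟_ xs) ≡ length xs ⇔ Unique xs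
  length-deduplicate≡length⇔Unique xs = mk⇔
    (λ eq → subst Unique (deduplicate-complete xs eq) (UniqueP.deduplicate-! _≟_ xs))
    (λ xs! → cong length (deduplicate-unique xs!))

xIndices : Monomial → List ℕ
xIndices []         = []
xIndices (x c ∷ vs) = c ∷ xIndices vs
xIndices (y _ ∷ vs) = xIndices vs

yIndices : Monomial → List ℕ
yIndices []         = []
yIndices (x _ ∷ vs) = yIndices vs
yIndices (y c ∷ vs) = c ∷ yIndices vs

module _ {c : ℕ} where

  All-x≢⇒All-≢-xIndices : ∀ {vs} → All (x c ≢_) vs → All (c ≢_) (xIndices vs)
  All-x≢⇒All-≢-xIndices {[]}       []       = []
  All-x≢⇒All-≢-xIndices {x _ ∷ vs} (p ∷ ps) = p ∘ cong x ∷ All-x≢⇒All-≢-xIndices ps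
  All-x≢⇒All-≢-xIndices {y _ ∷ vs} (_ ∷ ps) = All-x≢⇒All-≢-xIndices ps

  All-≢-xIndices⇒All-x≢ : ∀ {vs} → All (c ≢_) (xIndices vs) → All (x c ≢_) vs
  All-≢-xIndices⇒All-x≢ {[]}       []       = []
  All-≢-xIndices⇒All-x≢ {x _ ∷ vs} (p ∷ ps) = (λ { refl → p refl }) ∷ All-≢-xIndices⇒All-x≢ ps
  All-≢-xIndices⇒All-x≢ {y _ ∷ vs} ps       = (λ ()) ∷ All-≢-xIndices⇒All-x≢ ps

  All-y≢⇒All-≢-yIndices : ∀ {vs} → All (y c ≢_) vs → All (c ≢_) (yIndices vs)
  All-y≢⇒All-≢-yIndices {[]}       []       = []
  All-y≢⇒All-≢-yIndices {x _ ∷ vs} (_ ∷ ps) = All-y≢⇒All-≢-yIndices ps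
  All-y≢⇒All-≢-yIndices {y _ ∷ vs} (p ∷ ps) = p ∘ cong y ∷ All-y≢⇒All-≢-yIndices ps

  All-≢-yIndices⇒All-y≢ : ∀ {vs} → All (c ≢_) (yIndices vs) → All (y c ≢_) vs
  All-≢-yIndices⇒All-y≢ {[]}       []       = []
  All-≢-yIndices⇒All-y≢ {x _ ∷ vs} ps       = (λ ()) ∷ All-≢-yIndices⇒All-y≢ ps
  All-≢-yIndices⇒All-y≢ {y _ ∷ vs} (p ∷ ps) = (λ { refl → p refl }) ∷ All-≢-yIndices⇒All-y≢ ps

Unique⇔Unique-xyIndices : ∀ vs → Unique vs ⇔ (Unique (xIndices vs) × Unique (yIndices vs))
Unique⇔Unique-xyIndices vs = mk⇔ (split vs) (merge vs)
  where
  split : ∀ vs → Unique vs → Unique (xIndices vs) × Unique (yIndices vs)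
  split []         []        = [] , []
  split (x _ ∷ vs) (p ∷ vs!) = let xs! , ys! = split vs vs! in All-x≢⇒All-≢-xIndices p ∷ xs! , ys!
  split (y _ ∷ vs) (p ∷ vs!) = let xs! , ys! = split vs vs! in xs! , All-y≢⇒All-≢-yIndices p ∷ ys!

  merge : ∀ vs → Unique (xIndices vs) × Unique (yIndices vs) → Unique vs
  merge []         _                = []
  merge (x _ ∷ vs) (p ∷ xs! , ys!) = All-≢-xIndices⇒All-x≢ p ∷ merge vs (xs! , ys!)
  merge (y _ ∷ vs) (xs! , p ∷ ys!) = All-≢-yIndices⇒All-y≢ p ∷ merge vs (xs! , ys!)

numVars≡length⇔Unique : ∀ vs → numVars vs ≡ length vs ⇔ Unique vs
numVars≡length⇔Unique = length-deduplicate≡length⇔Unique _≟V_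

module _ {I : Set} (a b : I → ℕ) where

  xyMonomial : List I → Monomial
  xyMonomial = concatMap (λ i → x (a i) ∷ y (b i) ∷ [])

  xIndices-xyMonomial : ∀ is → xIndices (xyMonomial is) ≡ map a is
  xIndices-xyMonomial []       = refl
  xIndices-xyMonomial (i ∷ is) = cong (a i ∷_) (xIndices-xyMonomial is)

  yIndices-xyMonomial : ∀ is → yIndices (xyMonomial is) ≡ map b is
  yIndices-xyMonomial []       = refl
  yIndices-xyMonomial (i ∷ is) = cong (b i ∷_) (yIndices-xyMonomial is)

  length-xyMonomial : ∀ is → length (xyMonomial is) ≡ 2 * length is
  length-xyMonomial []       = refl
  length-xyMonomial (i ∷ is) = begin
    2 + length (xyMonomial is) ≡⟨ cong (λ m → 2 + m) (length-xyMonomial is) ⟩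
    2 + 2 * length is          ≡⟨ ℕP.*-suc 2 (length is) ⟨
    2 * suc (length is)        ∎
    where open ≡-Reasoning

module _ {I : Set} (a : I → ℕ) where

  xMonomial : List I → Monomial
  xMonomial = concatMap (λ i → x (a i) ∷ [])

  xIndices-xMonomial : ∀ is → xIndices (xMonomial is) ≡ map a is
  xIndices-xMonomial []       = refl
  xIndices-xMonomial (i ∷ is) = cong (a i ∷_) (xIndices-xMonomial is)

  yIndices-xMonomial : ∀ is → yIndices (xMonomial is) ≡ []
  yIndices-xMonomial []       = refl
  yIndices-xMonomial (i ∷ is) = yIndices-xMonomial is

  length-xMonomial : ∀ is → length (xMonomial is) ≡ length is
  length-xMonomial []       = refl
  length-xMonomial (i ∷ is) = cong suc (length-xMonomial is)

Unique-tabulate⁻ : ∀ {n} {A : Set} {f : Fin n → A} →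
                   Unique (tabulate f) → ∀ {i j} → f i ≡ f j → i ≡ j
Unique-tabulate⁻ _           {zero}  {zero}  _  = refl
Unique-tabulate⁻ (f0∉ ∷ _)   {zero}  {suc j} eq = ⊥-elim (AllP.tabulate⁻ f0∉ j eq)
Unique-tabulate⁻ (f0∉ ∷ _)   {suc i} {zero}  eq = ⊥-elim (AllP.tabulate⁻ f0∉ i (sym eq))
Unique-tabulate⁻ (_ ∷ tail!) {suc i} {suc j} eq = cong suc (Unique-tabulate⁻ tail! eq)

module _ {n : ℕ} {A : Set} where

  Injective⇔NoShare : (f : Fin n → A) → (∀ i j → f i ≡ f j → i ≡ j) ⇔ NoShare f
  Injective⇔NoShare f = mk⇔ (λ inj i j i≢j → i≢j ∘ inj i j) noShare⇒injective
    where
    noShare⇒injective : NoShare f → ∀ i j → f i ≡ f j → i ≡ j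
    noShare⇒injective ns i j eq with i FinP.≟ j
    ... | yes i≡j = i≡j
    ... | no  i≢j = ⊥-elim (ns i j i≢j eq)

  NoShare⇔Unique-tabulate : (f : Fin n → A) → NoShare f ⇔ Unique (tabulate f)
  NoShare⇔Unique-tabulate f = mk⇔ (λ ns → AllPairsP.tabulate⁺ (ns _ _))
                                  (λ f! i j i≢j → i≢j ∘ Unique-tabulate⁻ f!)

  NoShare-cong : {B : Set} {f : Fin n → A} {h : Fin n → B} →
                 (∀ i j → f i ≡ f j ⇔ h i ≡ h j) → NoShare f ⇔ NoShare h
  NoShare-cong f⇔h = mk⇔ (λ ns i j i≢j → ns i j i≢j ∘ from (f⇔h i j))
                         (λ ns i j i≢j → ns i j i≢j ∘ to (f⇔h i j))

  NoShare-resp-≗ : {f h : Fin n → A} → (∀ i → f i ≡ h i) → NoShare f ⇔ NoShare h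
  NoShare-resp-≗ f≗h = NoShare-cong λ i j →
    mk⇔ (λ eq → trans (sym (f≗h i)) (trans eq (f≗h j)))
        (λ eq → trans (f≗h i) (trans eq (sym (f≗h j))))

length-allFin : ∀ n → length (allFin n) ≡ n
length-allFin n = ListP.length-tabulate id

module _ {n : ℕ} where
  open EquationalReasoning

  numVars-xyMonomial : (a b : Fin n → ℕ) →
                       numVars (xyMonomial a b (allFin n)) ≡ 2 * n ⇔ (NoShare a × NoShare b)
  numVars-xyMonomial a b = begin
    numVars M ≡ 2 * n
      ≡⟨ cong (numVars M ≡_) (sym (trans (length-xyMonomial a b (allFin n))
                                         (cong (2 *_) (length-allFin n)))) ⟩
    numVars M ≡ length M
      ∼⟨ numVars≡length⇔Unique M ⟩
    Unique M
      ∼⟨ Unique⇔Unique-xyIndices M ⟩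
    (Unique (xIndices M) × Unique (yIndices M))
      ≡⟨ cong₂ (λ as bs → Unique as × Unique bs)
               (trans (xIndices-xyMonomial a b (allFin n)) (ListP.map-tabulate id a))
               (trans (yIndices-xyMonomial a b (allFin n)) (ListP.map-tabulate id b)) ⟩
    (Unique (tabulate a) × Unique (tabulate b))
      ∼⟨ ⇔.sym (NoShare⇔Unique-tabulate a ×-⇔ NoShare⇔Unique-tabulate b) ⟩
    (NoShare a × NoShare b) ∎
    where
    M : Monomial
    M = xyMonomial a b (allFin n)

  numVars-xMonomial : (a : Fin n → ℕ) → numVars (xMonomial a (allFin n)) ≡ n ⇔ NoShare a
  numVars-xMonomial a = begin
    numVars M ≡ n
      ≡⟨ cong (numVars M ≡_) (sym (trans (length-xMonomial a (allFin n)) (length-allFin n))) ⟩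
    numVars M ≡ length M
      ∼⟨ numVars≡length⇔Unique M ⟩
    Unique M
      ∼⟨ Unique⇔Unique-xyIndices M ⟩
    (Unique (xIndices M) × Unique (yIndices M))
      ≡⟨ cong₂ (λ as bs → Unique as × Unique bs)
               (trans (xIndices-xMonomial a (allFin n)) (ListP.map-tabulate id a))
               (yIndices-xMonomial a (allFin n)) ⟩
    (Unique (tabulate a) × Unique [])
      ∼⟨ mk⇔ proj₁ (_, []) ⟩
    Unique (tabulate a)
      ∼⟨ ⇔.sym (NoShare⇔Unique-tabulate a) ⟩
    NoShare a ∎
    where
    M : Monomial
    M = xMonomial a (allFin n)

monomial : ∀ {n} → (Fin n → Fin n → Monomial) → Vec (Fin n) n → Monomial
monomial {n} A σ = concatMap (λ i → A i (lookup σ i)) (allFin n)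

g-per≡count : ∀ {n} (A : Fin n → Fin n → Monomial) k
              {C : Vec (Fin n) n → Set} (C? : Decidable C) →
              (∀ σ → numVars (monomial A σ) ≡ k ⇔ C σ) →
              g (per A) k ≡ count (λ σ → noShare? FinP._≟_ (lookup σ) ×-dec C? σ) (allVecs n n)
g-per≡count {n} A k C? numVars⇔C = begin
  g (per A) k
    ≡⟨ g-unitTerms (monomial A) k (perms n) ⟩
  count (λ σ → numVars (monomial A σ) ℕP.≟ k) (filter isPerm? (allVecs n n))
    ≡⟨ count-filter isPerm? (λ σ → numVars (monomial A σ) ℕP.≟ k) _
         (λ σ → Injective⇔NoShare (lookup σ) ×-⇔ numVars⇔C σ) (allVecs n n) ⟩
  count (λ σ → noShare? FinP._≟_ (lookup σ) ×-dec C? σ) (allVecs n n) ∎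
  where open ≡-Reasoning

⊖-cancelʳ : ∀ n {a b} → a ⊖ n ≡ b ⊖ n → a ≡ b
⊖-cancelʳ n {a} {b} eq = ℤP.+-injective (∙-cancelʳ (- + n) (+ a) (+ b)
  (trans (ℤP.m-n≡m⊖n a n) (trans eq (sym (ℤP.m-n≡m⊖n b n)))))

[n∸r+c]⊖n≡c⊖r : ∀ {n r} c → r ≤ n → (n ∸ r + c) ⊖ n ≡ c ⊖ r
[n∸r+c]⊖n≡c⊖r {n} {r} c r≤n = begin
  (n ∸ r + c) ⊖ n           ≡⟨ cong ((n ∸ r + c) ⊖_) (ℕP.m∸n+n≡m r≤n) ⟨
  (n ∸ r + c) ⊖ (n ∸ r + r) ≡⟨ ℤP.+-cancelˡ-⊖ (n ∸ r) c r ⟩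
  c ⊖ r                     ∎
  where open ≡-Reasoning

-[k]%ℕn≡n∸k : ∀ {k n} .{{_ : NonZero n}} → 0 < k → k < n → (- + k) %ℕ n ≡ n ∸ k
-[k]%ℕn≡n∸k {suc k} _ k<n rewrite m<n⇒m%n≡m k<n = refl

-[n]%ℕn≡0 : ∀ n .{{_ : NonZero n}} → (- + n) %ℕ n ≡ 0
-[n]%ℕn≡0 n@(suc _) rewrite n%n≡0 n ⦃ _ ⦄ = refl

⊖-%ℕ : ∀ a n .{{_ : NonZero n}} → (a ⊖ n) %ℕ n ≡ a % n
⊖-%ℕ a n with n ℕP.≤? a
... | yes n≤a = trans (cong (_%ℕ n) (ℤP.⊖-≥ n≤a)) (m≤n⇒[n∸m]%m≡n%m n≤a)
... | no  n≰a = trans (cong (_%ℕ n) (ℤP.⊖-≰ n≰a)) (below a (ℕP.≰⇒> n≰a))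
  where
  below : ∀ b → b < n → (- + (n ∸ b)) %ℕ n ≡ b % n
  below zero    _   = trans (-[n]%ℕn≡0 n) (sym (m<n⇒m%n≡m (ℕ.>-nonZero⁻¹ n)))
  below (suc b) b<n = begin
    (- + (n ∸ suc b)) %ℕ n ≡⟨ -[k]%ℕn≡n∸k (ℕP.m<n⇒0<n∸m b<n) n∸suc-b<n ⟩
    n ∸ (n ∸ suc b)        ≡⟨ ℕP.m∸[m∸n]≡n (ℕP.<⇒≤ b<n) ⟩
    suc b                  ≡⟨ m<n⇒m%n≡m b<n ⟨
    suc b % n              ∎
    where
    open ≡-Reasoning
    n∸suc-b<n : n ∸ suc b < n
    n∸suc-b<n = ℕP.∸-monoʳ-< (s≤s z≤n) (ℕP.<⇒≤ b<n)

-- Adding c · (n − 1) turns the common summand c into a multiple of n.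
%-cancelʳ-+ : ∀ n .{{_ : NonZero n}} u u' c → (u + c) % n ≡ (u' + c) % n → u % n ≡ u' % n
%-cancelʳ-+ n@(suc n-1) u u' c eq = begin
  u % n                                         ≡⟨ [m+kn]%n≡m%n u c n ⟨
  (u + c * n) % n                               ≡⟨ cong (_% n) (regroup u) ⟩
  ((u + c) + c * n-1) % n                       ≡⟨ %-distribˡ-+ (u + c) (c * n-1) n ⟩
  ((u + c) % n + (c * n-1) % n) % n             ≡⟨ cong (λ r → (r + (c * n-1) % n) % n) eq ⟩
  ((u' + c) % n + (c * n-1) % n) % n            ≡⟨ %-distribˡ-+ (u' + c) (c * n-1) n ⟨
  ((u' + c) + c * n-1) % n                      ≡⟨ cong (_% n) (regroup u') ⟨
  (u' + c * n) % n                              ≡⟨ [m+kn]%n≡m%n u' c n ⟩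
  u' % n                                        ∎
  where
  open ≡-Reasoning
  regroup : ∀ v → v + c * n ≡ (v + c) + c * n-1
  regroup v = trans (cong (λ w → v + w) (ℕP.*-suc c n-1)) (sym (ℕP.+-assoc v c (c * n-1)))

%-complement : ∀ n .{{_ : NonZero n}} {u s u' s'} →
               u + s ≡ u' + s' → s % n ≡ s' % n → u % n ≡ u' % n
%-complement n {u} {s} {u'} {s'} u+s≡u'+s' s≡s' = %-cancelʳ-+ n u u' s' (begin
  (u + s') % n                   ≡⟨ %-distribˡ-+ u s' n ⟩
  (u % n + s' % n) % n           ≡⟨ cong (λ r → (u % n + r) % n) s≡s' ⟨
  (u % n + s % n) % n            ≡⟨ %-distribˡ-+ u s n ⟨
  (u + s) % n                    ≡⟨ cong (_% n) u+s≡u'+s' ⟩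
  (u' + s') % n                  ∎)
  where open ≡-Reasoning

[m∸s+1]+s≡m+1 : ∀ {m s} → s ≤ m → m ∸ s + 1 + s ≡ m + 1
[m∸s+1]+s≡m+1 {m} {s} s≤m = begin
  m ∸ s + 1 + s   ≡⟨ ℕP.+-assoc (m ∸ s) 1 s ⟩
  m ∸ s + suc s   ≡⟨ ℕP.+-suc (m ∸ s) s ⟩
  suc (m ∸ s + s) ≡⟨ cong suc (ℕP.m∸n+n≡m s≤m) ⟩
  suc m           ≡⟨ ℕP.+-comm 1 m ⟩
  m + 1           ∎
  where open ≡-Reasoning

complement-⇔ : ∀ {m s s'} → s ≤ m → s' ≤ m → (m ∸ s + 1 ≡ m ∸ s' + 1) ⇔ (s ≡ s')
complement-⇔ {m} s≤m s'≤m =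
  mk⇔ (ℕP.∸-cancelˡ-≡ s≤m s'≤m ∘ ℕP.+-cancelʳ-≡ 1 _ _) (cong (λ s → m ∸ s + 1))

complement-%-⇔ : ∀ n .{{_ : NonZero n}} {m s s'} → s ≤ m → s' ≤ m →
                 ((m ∸ s + 1) % n ≡ (m ∸ s' + 1) % n) ⇔ (s % n ≡ s' % n)
complement-%-⇔ n {m} {s} {s'} s≤m s'≤m = mk⇔
  (%-complement n (trans (ℕP.+-comm s _) (trans total (ℕP.+-comm _ s'))))
  (%-complement n total)
  where
  total : m ∸ s + 1 + s ≡ m ∸ s' + 1 + s'
  total = trans ([m∸s+1]+s≡m+1 s≤m) (sym ([m∸s+1]+s≡m+1 s'≤m))

module _ {n : ℕ} (σ : Vec (Fin n) n) where

  diagonalIndex : Fin n → ℕ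
  diagonalIndex i = n ∸ row i + row (lookup σ i)

  antidiagonalIndex : Fin n → ℕ
  antidiagonalIndex i = 2 * n ∸ sm σ i + 1

  sm≤2n : ∀ i → sm σ i ≤ 2 * n
  sm≤2n i = ℕP.+-mono-≤ (FinP.toℕ<n i) (ℕP.≤-trans (FinP.toℕ<n (lookup σ i)) (ℕP.m≤m+n n 0))

  diagonalIndex⊖n≡dif : ∀ i → diagonalIndex i ⊖ n ≡ dif σ i
  diagonalIndex⊖n≡dif i =
    trans ([n∸r+c]⊖n≡c⊖r _ (FinP.toℕ<n i)) (sym (ℤP.m-n≡m⊖n (row (lookup σ i)) (row i)))

  NoShare-diagonalIndex : NoShare diagonalIndex ⇔ NoShare (dif σ)
  NoShare-diagonalIndex = ⇔.trans (NoShare-cong λ _ _ → mk⇔ (cong (_⊖ n)) (⊖-cancelʳ n))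
                                  (NoShare-resp-≗ diagonalIndex⊖n≡dif)

  NoShare-antidiagonalIndex : NoShare antidiagonalIndex ⇔ NoShare (sm σ)
  NoShare-antidiagonalIndex = NoShare-cong λ i j → complement-⇔ (sm≤2n i) (sm≤2n j)

  module _ .{{_ : NonZero n}} where

    NoShare-diagonalIndex%n : NoShare (λ i → diagonalIndex i % n) ⇔ NoShare (λ i → dif σ i %ℕ n)
    NoShare-diagonalIndex%n = NoShare-resp-≗ λ i →
      trans (sym (⊖-%ℕ (diagonalIndex i) n)) (cong (_%ℕ n) (diagonalIndex⊖n≡dif i))

    NoShare-antidiagonalIndex%n : NoShare (λ i → antidiagonalIndex i % n) ⇔ NoShare (λ i → sm σ i % n)
    NoShare-antidiagonalIndex%n = NoShare-cong λ i j → complement-%-⇔ n (sm≤2n i) (sm≤2n j)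

lemma3p3 : (n : ℕ) .{{_ : NonZero n}} →
    (g (per (Qmat n)) (2 * n) ≡ Q n) × (g (per (Tmat n)) (2 * n) ≡ T n) ×
    (g (per (Smat n)) n ≡ S n) × (g (per (Zmat n)) n ≡ TS n)
lemma3p3 n =
    g-per≡count (Qmat n) (2 * n) _ (λ σ →
      ⇔.trans (numVars-xyMonomial (diagonalIndex σ) (antidiagonalIndex σ))
              (NoShare-diagonalIndex σ ×-⇔ NoShare-antidiagonalIndex σ))
  , g-per≡count (Tmat n) (2 * n) _ (λ σ →
      ⇔.trans (numVars-xyMonomial (λ i → diagonalIndex σ i % n)
                                  (λ i → antidiagonalIndex σ i % n))
              (NoShare-diagonalIndex%n σ ×-⇔ NoShare-antidiagonalIndex%n σ))
  , g-per≡count (Smat n) n _ (λ σ →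
      ⇔.trans (numVars-xMonomial (diagonalIndex σ)) (NoShare-diagonalIndex σ))
  , g-per≡count (Zmat n) n _ (λ σ →
      ⇔.trans (numVars-xMonomial (λ i → diagonalIndex σ i % n)) (NoShare-diagonalIndex%n σ))
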